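{- Let $G,H$ be finite groups of order $n$, and consider the Version II pebble game on $G,H$; let $f:G\to H$ be a bijection chosen by Duplicator. (a) If $f(Z(G))\neq Z(H)$, then Spoiler can win with $2$ pebbles and $2$ rounds. (b) If there exist $x,y\in G$ such that $f([x,y])$ is not a commutator $[h,h']$ for any $h,h'\in H$, then Spoiler can win with $3$ pebbles and $3$ rounds. (c) If there exists $g\in G$ with $\mathrm{cw}(g)\neq\mathrm{cw}(f(g))$, then Spoiler can win with $4$ pebbles and $O(\log \mathrm{cw}(G))\leq O(\log n)$ rounds.
   Context: $Z(G)$ is the center. $[x,y]$ denotes the commutator. The commutator width $\mathrm{cw}(g)$ of $g$ is the minimum length of a word in commutators $\{[a,b]: a,b\in G\}$ equal to $g$ ($\infty$ if none); $\mathrm{cw}(G)$ is the maximum of $\mathrm{cw}(g)$ over $g\in[G,G]$. The Version II pebble game on $G,H$: each round, (1) Spoiler picks up a pebble pair $(p_i,p_i')$; (2) if the map sending each pebbled element of $G$ to the correspondingly pebbled element of $H$ does not extend to an isomorphism of the generated subgroups, Spoiler wins; (3) Duplicator chooses a bijection $f:G\to H$; (4) Spoiler places $p_i$ on some $g\in G$ and $p_i'$ on $f(g)$. "Spoiler can win with $m$ pebbles and $t$ rounds" means Spoiler has a strategy from the current position using at most $m$ pebble pairs that wins within $t$ further rounds. -}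

module Defs where

open import Level using (0ℓ)
open import Data.Nat using (ℕ; zero; suc; _<_)
open import Data.Fin using (Fin; _≟_)
open import Data.Maybe using (Maybe; just; nothing; maybe)
open import Data.Product using (Σ; ∃; _×_; _,_; proj₁; proj₂)
open import Data.List using (List; []; _∷_; length)
open import Relation.Binary.PropositionalEquality using (_≡_)
open import Relation.Nullary using (¬_; yes; no)
open import Data.Sum using (_⊎_)
open import Algebra.Structures using (IsGroup)
open import Function.Bundles using (_⤖_; Bijection)

-- A finite group of order n: a group structure on Fin n with
-- propositional equality (every finite group of order n is isomorphic
-- to one of this form).

record FinGroup (n : ℕ) : Set where
  field
    _∙_     : Fin n → Fin n → Fin n
    ε       : Fin n
    _⁻¹     : Fin n → Fin n
    isGroup : IsGroup {A = Fin n} _≡_ _∙_ ε _⁻¹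
  infixl 7 _∙_
  infix 8 _⁻¹

module _ {n : ℕ} (G : FinGroup n) where
  open FinGroup G

  comm : Fin n → Fin n → Fin n
  comm x y = x ⁻¹ ∙ y ⁻¹ ∙ x ∙ y

  InCenter : Fin n → Set
  InCenter z = ∀ x → z ∙ x ≡ x ∙ z

  IsCommutator : Fin n → Set
  IsCommutator g = Σ (Fin n) λ a → Σ (Fin n) λ b → comm a b ≡ g

  prodComm : List (Fin n × Fin n) → Fin n
  prodComm [] = ε
  prodComm ((a , b) ∷ ps) = comm a b ∙ prodComm ps

  CommLen : Fin n → ℕ → Set
  CommLen g k = Σ (List (Fin n × Fin n)) λ ps → length ps ≡ k × prodComm ps ≡ g

  -- cw(g) = c, where c : Maybe ℕ, nothing standing for ∞
  CW : Fin n → Maybe ℕ → Set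
  CW g (just k) = CommLen g k × (∀ j → j < k → ¬ CommLen g j)
  CW g nothing  = ∀ j → ¬ CommLen g j

  -- membership in [G,G] (products of commutators; inverses of
  -- commutators are commutators)
  InDerived : Fin n → Set
  InDerived g = Σ ℕ λ k → CommLen g k

  CWGroup : ℕ → Set
  CWGroup k = (Σ (Fin n) λ g → CW g (just k))
            × (∀ g → InDerived g → Σ ℕ λ j → CW g (just j) × (j Data.Nat.≤ k))

data Word (m : ℕ) : Set where
  var : Fin m → Word m
  one : Word m
  inv : Word m → Word m
  mul : Word m → Word m → Word m

module _ {n : ℕ} (G : FinGroup n) where
  open FinGroup G

  eval : {m : ℕ} → (Fin m → Fin n) → Word m → Fin n
  eval gs (var i)   = gs i
  eval gs one       = ε
  eval gs (inv w)   = eval gs w ⁻¹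
  eval gs (mul v w) = eval gs v ∙ eval gs w

  InGen : {m : ℕ} → (Fin m → Fin n) → Fin n → Set
  InGen gs x = Σ (Word _) λ w → eval gs w ≡ x

ExtendsToIso : {n m : ℕ} (G H : FinGroup n) → (Fin m → Fin n) → (Fin m → Fin n) → Set
ExtendsToIso {n} G H gs hs =
  Σ (Fin n → Fin n) λ φ →
      (∀ i → φ (gs i) ≡ hs i)
    × (∀ x → InGen G gs x → InGen H hs (φ x))
    × (∀ x y → InGen G gs x → InGen G gs y →
         φ (FinGroup._∙_ G x y) ≡ FinGroup._∙_ H (φ x) (φ y))
    × (∀ x y → InGen G gs x → InGen G gs y → φ x ≡ φ y → x ≡ y)
    × (∀ z → InGen H hs z → Σ (Fin n) λ x → InGen G gs x × φ x ≡ z)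

Config : ℕ → ℕ → Set
Config m n = Fin m → Maybe (Fin n × Fin n)

place : {m n : ℕ} → Config m n → Fin m → Fin n × Fin n → Config m n
place c i p j with j ≟ i
... | yes _ = just p
... | no _  = c j

-- pebbled elements (unplaced pebbles contribute the identity, which
-- does not change the generated subgroups)
pebG : {m n : ℕ} (G : FinGroup n) → Config m n → Fin m → Fin n
pebG G c i = maybe proj₁ (FinGroup.ε G) (c i)

pebH : {m n : ℕ} (H : FinGroup n) → Config m n → Fin m → Fin n
pebH H c i = maybe proj₂ (FinGroup.ε H) (c i)

Good : {m n : ℕ} (G H : FinGroup n) → Config m n → Set
Good G H c = ExtendsToIso G H (pebG G c) (pebH H c)

-- Spoiler wins within t further rounds from configuration c
-- (a round: Spoiler picks pebble pair i, Duplicator picks a bijection f,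
--  Spoiler places pebble pair i on (g , f g); Spoiler wins as soon as the
--  pebbled map does not extend to an isomorphism).
SpoilerWins : {m n : ℕ} (G H : FinGroup n) → ℕ → Config m n → Set
SpoilerWins {m} {n} G H zero c = ¬ Good G H c
SpoilerWins {m} {n} G H (suc t) c =
  ¬ Good G H c
  ⊎ Σ (Fin m) λ i → (f : Fin n ⤖ Fin n) →
      Σ (Fin n) λ g → SpoilerWins G H t (place c i (g , Bijection.to f g))

ImageCenterEq : {n : ℕ} (G H : FinGroup n) → (Fin n → Fin n) → Set
ImageCenterEq G H f =
    (∀ z → InCenter G z → InCenter H (f z))
  × (∀ h → InCenter H h → ∃ λ z → InCenter G z × f z ≡ h)

{-# OPTIONS --safe #-}
-- Spoiler wins as soon as the pebbled tuples satisfy different word relations in G and H.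
-- (a) If z is central but f z is not, Spoiler pebbles z and then the preimage of an element
-- not commuting with f z. (b) Spoiler pebbles [x,y] and then x and y: the relation p = [q,r]
-- holds in G but cannot hold in H. (c) If g is a product of M ≤ 2^e commutators in G but its
-- image is not such a product in H, Spoiler pebbles the two halves u, v of a shortest word for
-- g. Either p = q r fails in H, or one of Duplicator's answers is not a product of the
-- corresponding number of commutators, and Spoiler recurses on it, reusing the freed pebble:
-- two rounds per halving, O(log M) rounds in all. A width mismatch yields such an M ≤ cw(G),
-- except when g ∉ [G,G] and cw(f g) > cw(G); then a prefix of a shortest word for f g has
-- width exactly cw(G) + 1, which no element of G has.
module Submission where

open import Defs
open import Data.Nat using (ℕ; suc; _*_; _+_; _≤_)
open import Data.Nat.Logarithm using (⌊log₂_⌋)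
open import Data.Fin using (Fin)
open import Data.Maybe using (Maybe)
open import Data.Product using (Σ; _×_; _,_)
open import Relation.Binary.PropositionalEquality using (_≡_; _≢_)
open import Relation.Nullary using (¬_)
open import Function.Bundles using (_⤖_; Bijection)

open import Level using (0ℓ)
open import Data.Nat using (zero; _<_; _∸_; _⊓_; _^_; _≤?_; _≤′_; ≤′-refl; ≤′-step; z≤n; s≤s)
open import Data.Nat.Properties hiding (_≟_)
open import Data.Nat.Logarithm using (⌊log₂⌋-mono-≤; ⌊log₂[2^n]⌋≡n)
open import Data.Fin using (zero; suc; toℕ; punchIn; _≟_)
open import Data.Fin.Properties using (any?; all?; ¬∀⟶∃¬; pigeonhole; toℕ<n; punchInᵢ≢i; punchIn-injective)
open import Data.Vec.Functional using (updateAt)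
open import Data.Vec.Functional.Properties using (updateAt-updates; updateAt-minimal)
open import Data.List using (List; []; _∷_; length; _++_; take; drop)
open import Data.List.Properties using (length-++; length-take; length-drop; take++drop≡id)
open import Data.Maybe using (just; nothing; maybe)
open import Data.Product using (proj₁; proj₂)
open import Data.Sum using (_⊎_; inj₁; inj₂)
open import Data.Empty using (⊥-elim)
open import Function using (_∘_; const)
open import Relation.Binary.PropositionalEquality
  using (refl; sym; trans; cong; cong₂; subst; subst₂; _≗_; module ≡-Reasoning)
open import Relation.Binary.Definitions using (tri<; tri≈; tri>)
open import Relation.Nullary using (Dec; yes; no; ¬?; _×-dec_; _⊎-dec_)
open import Relation.Nullary.Decidable using (decidable-stable)
open import Function.Properties.Bijection using (sym-≡)
open import Algebra.Structures using (IsGroup)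
open import Algebra.Bundles using (Group)
import Algebra.Properties.Group as GroupProperties

module FinGroupProperties {n : ℕ} (G : FinGroup n) where
  open FinGroup G public
  open IsGroup isGroup public using (assoc; identityˡ; identityʳ; inverseˡ)

  private
    group : Group 0ℓ 0ℓ
    group = record { isGroup = isGroup }

  open GroupProperties group public using (ε⁻¹≈ε; inverseˡ-unique; identityˡ-unique)

  comm-ε-ε : comm G ε ε ≡ ε
  comm-ε-ε = begin
    ε ⁻¹ ∙ ε ⁻¹ ∙ ε ∙ ε  ≡⟨ cong (λ e → e ∙ e ∙ ε ∙ ε) ε⁻¹≈ε ⟩
    ε ∙ ε ∙ ε ∙ ε        ≡⟨ identityʳ _ ⟩
    ε ∙ ε ∙ ε            ≡⟨ identityʳ _ ⟩
    ε ∙ ε                ≡⟨ identityʳ _ ⟩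
    ε                    ∎
    where open ≡-Reasoning

  prodComm-++ : ∀ xs ys → prodComm G (xs ++ ys) ≡ prodComm G xs ∙ prodComm G ys
  prodComm-++ []             ys = sym (identityˡ _)
  prodComm-++ ((a , b) ∷ xs) ys =
    trans (cong (comm G a b ∙_) (prodComm-++ xs ys)) (sym (assoc _ _ _))

  CommLen-∙ : ∀ {u v a b} → CommLen G u a → CommLen G v b → CommLen G (u ∙ v) (a + b)
  CommLen-∙ (xs , refl , refl) (ys , refl , refl) = xs ++ ys , length-++ xs , prodComm-++ xs ys

  CommLen-split : ∀ a b {x} → CommLen G x (a + b) →
    Σ (Fin n) λ u → Σ (Fin n) λ v → CommLen G u a × CommLen G v b × u ∙ v ≡ x
  CommLen-split a b (ps , len , prod) =
      prodComm G (take a ps) , prodComm G (drop a ps)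
    , (take a ps , trans (length-take a ps) (trans (cong (a ⊓_) len) (m≤n⇒m⊓n≡m (m≤m+n a b))) , refl)
    , (drop a ps , trans (length-drop a ps) (trans (cong (_∸ a) len) (m+n∸m≡n a b)) , refl)
    , trans (sym (prodComm-++ (take a ps) (drop a ps))) (trans (cong (prodComm G) (take++drop≡id a ps)) prod)

  CommLen-suc : ∀ {x j} → CommLen G x j → CommLen G x (suc j)
  CommLen-suc (ps , len , prod) =
    (ε , ε) ∷ ps , cong suc len , trans (cong (_∙ prodComm G ps) comm-ε-ε) (trans (identityˡ _) prod)

  CommLen-mono : ∀ {x j k} → j ≤ k → CommLen G x j → CommLen G x k
  CommLen-mono = go ∘ ≤⇒≤′
    where
    go : ∀ {x j k} → j ≤′ k → CommLen G x j → CommLen G x k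
    go ≤′-refl        cl = cl
    go (≤′-step j≤′k) cl = CommLen-suc (go j≤′k cl)

  CommLen-zero⇒ε : ∀ {x} → CommLen G x 0 → x ≡ ε
  CommLen-zero⇒ε ([] , _ , prod) = sym prod

  CommLen-one⇒IsCommutator : ∀ {x} → CommLen G x 1 → IsCommutator G x
  CommLen-one⇒IsCommutator (((a , b) ∷ []) , _ , prod) = a , b , trans (sym (identityʳ _)) prod

  IsCommutator⇒CommLen-one : ∀ {x} → IsCommutator G x → CommLen G x 1
  IsCommutator⇒CommLen-one (a , b , [a,b]≡x) = (a , b) ∷ [] , refl , trans (identityʳ _) [a,b]≡x

  CommLen? : ∀ x j → Dec (CommLen G x j)
  CommLen? x zero with ε ≟ x
  ... | yes ε≡x = yes ([] , refl , ε≡x)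
  ... | no  ε≢x = no λ { ([] , _ , ε≡x) → ε≢x ε≡x }
  CommLen? x (suc j)
    with any? (λ a → any? (λ b → any? (λ z → CommLen? z j ×-dec (comm G a b ∙ z ≟ x))))
  ... | yes (a , b , _ , (ps , len , refl) , prod) = yes ((a , b) ∷ ps , cong suc len , prod)
  ... | no none = no λ { ((a , b) ∷ ps , len , prod) →
                           none (a , b , _ , (ps , suc-injective len , refl) , prod) }

  ¬CommLen-∙ : ∀ {u v a b} → ¬ CommLen G (u ∙ v) (a + b) → ¬ CommLen G u a ⊎ ¬ CommLen G v b
  ¬CommLen-∙ {u} {a = a} ¬uv with CommLen? u a
  ... | yes cu  = inj₂ (¬uv ∘ CommLen-∙ cu)
  ... | no  ¬cu = inj₁ ¬cu

  InCenter? : ∀ z → Dec (InCenter G z)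
  InCenter? z = all? λ x → z ∙ x ≟ x ∙ z

  CW-minimal : ∀ {x a j} → CW G x (just a) → CommLen G x j → a ≤ j
  CW-minimal (_ , minimal) cl = ≮⇒≥ λ j<a → minimal _ j<a cl

  CWGroup⇒CommLen : ∀ {k x j} → CWGroup G k → CommLen G x j → CommLen G x k
  CWGroup⇒CommLen (_ , bounded) cl with bounded _ (_ , cl)
  ... | _ , (cl′ , _) , j′≤k = CommLen-mono j′≤k cl′

  CWGroup⇒CW≤ : ∀ {k x a} → CWGroup G k → CW G x (just a) → a ≤ k
  CWGroup⇒CW≤ cwG cw@(cl , _) = CW-minimal cw (CWGroup⇒CommLen cwG cl)

  CW-prefix : ∀ a d {y} → CW G y (just (a + d)) → Σ (Fin n) λ u → CW G u (just a)
  CW-prefix a d (cl , minimal) with CommLen-split a d cl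
  ... | u , v , cu , cv , uv≡y =
    u , cu , λ j j<a cj →
      minimal (j + d) (+-monoˡ-< d j<a) (subst (λ z → CommLen G z (j + d)) uv≡y (CommLen-∙ cj cv))

  prodComm-repeated-prefix : ∀ ps {a b} → a < b → b ≤ length ps →
    prodComm G (take a ps) ≡ prodComm G (take b ps) →
    Σ (List (Fin n × Fin n)) λ ws → length ws < length ps × prodComm G ws ≡ prodComm G ps
  prodComm-repeated-prefix ps {a} {b} a<b b≤len same = take a ps ++ drop b ps , shorter , same-product
    where
    shorter : length (take a ps ++ drop b ps) < length ps
    shorter = begin-strict
      length (take a ps ++ drop b ps)          ≡⟨ length-++ (take a ps) ⟩
      length (take a ps) + length (drop b ps)  ≡⟨ cong₂ _+_ (length-take a ps) (length-drop b ps) ⟩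
      a ⊓ length ps + (length ps ∸ b)          ≤⟨ +-monoˡ-≤ _ (m⊓n≤m a (length ps)) ⟩
      a + (length ps ∸ b)                      <⟨ +-monoˡ-< _ a<b ⟩
      b + (length ps ∸ b)                      ≡⟨ m+[n∸m]≡n b≤len ⟩
      length ps                                ∎
      where open ≤-Reasoning
    same-product : prodComm G (take a ps ++ drop b ps) ≡ prodComm G ps
    same-product = begin
      prodComm G (take a ps ++ drop b ps)               ≡⟨ prodComm-++ (take a ps) (drop b ps) ⟩
      prodComm G (take a ps) ∙ prodComm G (drop b ps)   ≡⟨ cong (_∙ prodComm G (drop b ps)) same ⟩
      prodComm G (take b ps) ∙ prodComm G (drop b ps)   ≡⟨ prodComm-++ (take b ps) (drop b ps) ⟨
      prodComm G (take b ps ++ drop b ps)               ≡⟨ cong (prodComm G) (take++drop≡id b ps) ⟩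
      prodComm G ps                                     ∎
      where open ≡-Reasoning

  -- The k + 1 prefix products of a shortest word are pairwise distinct.
  CW⇒<order : ∀ {g k} → CW G g (just k) → k < n
  CW⇒<order ((ps , refl , prod) , minimal) = ≮⇒≥ λ n<1+len →
    let (i , j , i<j , same) = pigeonhole n<1+len (λ i → prodComm G (take (toℕ i) ps))
        (ws , shorter , ws≡ps) = prodComm-repeated-prefix ps i<j (≤-pred (toℕ<n j)) same
    in minimal (length ws) shorter (ws , refl , trans ws≡ps prod)

infixl 6 _[_]≔_
_[_]≔_ : ∀ {m} {A : Set} → (Fin m → A) → Fin m → A → Fin m → A
xs [ i ]≔ x = updateAt xs i (const x)

[]≔-updates : ∀ {m} {A : Set} (xs : Fin m → A) i x → (xs [ i ]≔ x) i ≡ x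
[]≔-updates xs i x = updateAt-updates i xs

[]≔-twice : ∀ {m} {A : Set} (xs : Fin m → A) {p q r} x y → p ≢ q → p ≢ r → q ≢ r →
  (xs [ q ]≔ x [ r ]≔ y) p ≡ xs p × (xs [ q ]≔ x [ r ]≔ y) q ≡ x × (xs [ q ]≔ x [ r ]≔ y) r ≡ y
[]≔-twice xs {p} {q} {r} x y p≢q p≢r q≢r =
    trans (updateAt-minimal p r _ p≢r) (updateAt-minimal p q xs p≢q)
  , trans (updateAt-minimal q r _ q≢r) (updateAt-updates q xs)
  , updateAt-updates r _

Distinct₃ : ∀ {m} → Fin m → Fin m → Fin m → Set
Distinct₃ p q r = p ≢ q × p ≢ r × q ≢ r

distinct-from : ∀ {m} (p : Fin (3 + m)) → Σ (Fin (3 + m)) λ q → Σ (Fin (3 + m)) λ r → Distinct₃ p q r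
distinct-from p =
    punchIn p zero , punchIn p (suc zero)
  , punchInᵢ≢i p zero ∘ sym , punchInᵢ≢i p (suc zero) ∘ sym , (λ ()) ∘ punchIn-injective p zero (suc zero)

Consistent : ∀ {m n} (G H : FinGroup n) → (Fin m → Fin n) → (Fin m → Fin n) → Set
Consistent G H gs hs = ∀ v w → (eval G gs v ≡ eval G gs w → eval H hs v ≡ eval H hs w)
                             × (eval H hs v ≡ eval H hs w → eval G gs v ≡ eval G gs w)

module _ {m n : ℕ} (G H : FinGroup n) where
  private
    module G = FinGroupProperties G
    module H = FinGroupProperties H

  Consistent-sym : {gs hs : Fin m → Fin n} → Consistent G H gs hs → Consistent H G hs gs
  Consistent-sym consistent v w = proj₂ (consistent v w) , proj₁ (consistent v w)

  relation-violated : ∀ {gs hs : Fin m → Fin n} v w →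
    eval G gs v ≡ eval G gs w → eval H hs v ≢ eval H hs w → ¬ Consistent G H gs hs
  relation-violated v w holds fails consistent = fails (proj₁ (consistent v w) holds)

  ExtendsToIso⇒Consistent : ∀ {gs hs : Fin m → Fin n} → ExtendsToIso G H gs hs → Consistent G H gs hs
  ExtendsToIso⇒Consistent {gs} {hs} (φ , φ-gens , _ , φ-∙ , φ-injective , _) v w =
      (λ eq → trans (sym (φ-eval v)) (trans (cong φ eq) (φ-eval w)))
    , (λ eq → φ-injective _ _ (v , refl) (w , refl) (trans (φ-eval v) (trans eq (sym (φ-eval w)))))
    where
    φ-ε : φ G.ε ≡ H.ε
    φ-ε = H.identityˡ-unique _ _
      (trans (sym (φ-∙ _ _ (one , refl) (one , refl))) (cong φ (G.identityˡ _)))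

    φ-eval : ∀ w → φ (eval G gs w) ≡ eval H hs w
    φ-eval (var i)   = φ-gens i
    φ-eval one       = φ-ε
    φ-eval (inv w)   = trans
      (H.inverseˡ-unique _ _ (trans (sym (φ-∙ _ _ (inv w , refl) (w , refl)))
                                    (trans (cong φ (G.inverseˡ _)) φ-ε)))
      (cong H._⁻¹ (φ-eval w))
    φ-eval (mul v w) = trans (φ-∙ _ _ (v , refl) (w , refl)) (cong₂ H._∙_ (φ-eval v) (φ-eval w))

eval-cong : ∀ {m n} (K : FinGroup n) {gs gs′ : Fin m → Fin n} → gs ≗ gs′ → ∀ w → eval K gs w ≡ eval K gs′ w
eval-cong K gs≗ (var i)   = gs≗ i
eval-cong K gs≗ one       = refl
eval-cong K gs≗ (inv w)   = cong (FinGroup._⁻¹ K) (eval-cong K gs≗ w)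
eval-cong K gs≗ (mul v w) = cong₂ (FinGroup._∙_ K) (eval-cong K gs≗ v) (eval-cong K gs≗ w)

Consistent-cong : ∀ {m n} (G H : FinGroup n) {gs gs′ hs hs′ : Fin m → Fin n} →
  gs ≗ gs′ → hs ≗ hs′ → Consistent G H gs hs → Consistent G H gs′ hs′
Consistent-cong G H gs≗ hs≗ consistent v w =
    (λ eq → transport H hs≗ (proj₁ (consistent v w) (transport G (sym ∘ gs≗) eq)))
  , (λ eq → transport G gs≗ (proj₂ (consistent v w) (transport H (sym ∘ hs≗) eq)))
  where
  transport : ∀ K {xs ys} → xs ≗ ys → eval K xs v ≡ eval K xs w → eval K ys v ≡ eval K ys w
  transport K xs≗ys eq = trans (sym (eval-cong K xs≗ys v)) (trans eq (eval-cong K xs≗ys w))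

-- The pebble game played on the tuples of pebbled elements, where Spoiler wins as soon as the
-- tuples are not Consistent, which already rules out ExtendsToIso; unlike SpoilerWins
-- it is symmetric in G and H.
Wins : ∀ {m n} (G H : FinGroup n) → ℕ → (Fin m → Fin n) → (Fin m → Fin n) → Set
Wins G H zero gs hs = ¬ Consistent G H gs hs
Wins {m} {n} G H (suc t) gs hs = ¬ Consistent G H gs hs ⊎
  Σ (Fin m) λ i → (f : Fin n ⤖ Fin n) →
    Σ (Fin n) λ g → Wins G H t (gs [ i ]≔ g) (hs [ i ]≔ Bijection.to f g)

module _ {m n : ℕ} (G H : FinGroup n) where

  ¬Consistent⇒Wins : ∀ t {gs hs : Fin m → Fin n} → ¬ Consistent G H gs hs → Wins G H t gs hs
  ¬Consistent⇒Wins zero    inconsistent = inconsistent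
  ¬Consistent⇒Wins (suc t) inconsistent = inj₁ inconsistent

  Wins-mono : ∀ {t t′} {gs hs : Fin m → Fin n} → t ≤ t′ → Wins G H t gs hs → Wins G H t′ gs hs
  Wins-mono {t′ = t′} z≤n        win                = ¬Consistent⇒Wins t′ win
  Wins-mono           (s≤s t≤t′) (inj₁ inconsistent) = inj₁ inconsistent
  Wins-mono           (s≤s t≤t′) (inj₂ (i , answer)) =
    inj₂ (i , λ f → proj₁ (answer f) , Wins-mono t≤t′ (proj₂ (answer f)))

to∘to-sym-≡ : ∀ {n} (f : Fin n ⤖ Fin n) h → Bijection.to f (Bijection.to (sym-≡ f) h) ≡ h
to∘to-sym-≡ f h = proj₂ (Bijection.strictlySurjective f h)

Wins-swap : ∀ {m n} (G H : FinGroup n) t {gs hs : Fin m → Fin n} → Wins H G t hs gs → Wins G H t gs hs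
Wins-swap G H zero    win                = win ∘ Consistent-sym G H
Wins-swap G H (suc t) (inj₁ inconsistent) = inj₁ (inconsistent ∘ Consistent-sym G H)
Wins-swap G H (suc t) {gs} {hs} (inj₂ (i , answer)) = inj₂ (i , λ f →
  let f⁻¹ = sym-≡ f
      h   = proj₁ (answer f⁻¹)
  in Bijection.to f⁻¹ h ,
     subst (λ h′ → Wins G H t (gs [ i ]≔ Bijection.to f⁻¹ h) (hs [ i ]≔ h′)) (sym (to∘to-sym-≡ f h))
           (Wins-swap G H t (proj₂ (answer f⁻¹))))

place-≗ : ∀ {m n} (π : Fin n × Fin n → Fin n) e {c : Config m n} {xs : Fin m → Fin n} i p →
  (∀ j → xs j ≡ maybe π e (c j)) → ∀ j → (xs [ i ]≔ π p) j ≡ maybe π e (place c i p j)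
place-≗ π e {xs = xs} i p xs≗ j with j ≟ i
... | yes refl = updateAt-updates j xs
... | no  j≢i  = trans (updateAt-minimal j i xs j≢i) (xs≗ j)

Wins⇒SpoilerWins : ∀ {m n} (G H : FinGroup n) t (c : Config m n) {gs hs : Fin m → Fin n} →
  gs ≗ pebG G c → hs ≗ pebH H c → Wins G H t gs hs → SpoilerWins G H t c
Wins⇒SpoilerWins G H zero c gs≗ hs≗ win =
  win ∘ Consistent-cong G H (sym ∘ gs≗) (sym ∘ hs≗) ∘ ExtendsToIso⇒Consistent G H
Wins⇒SpoilerWins G H (suc t) c gs≗ hs≗ (inj₁ inconsistent) =
  inj₁ (inconsistent ∘ Consistent-cong G H (sym ∘ gs≗) (sym ∘ hs≗) ∘ ExtendsToIso⇒Consistent G H)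
Wins⇒SpoilerWins G H (suc t) c gs≗ hs≗ (inj₂ (i , answer)) = inj₂ (i , λ f →
  let g = proj₁ (answer f) ; y = Bijection.to f g
  in g , Wins⇒SpoilerWins G H t (place c i (g , y))
           (place-≗ proj₁ _ i (g , y) gs≗) (place-≗ proj₂ _ i (g , y) hs≗) (proj₂ (answer f)))

Wins-placed⇒SpoilerWins : ∀ {m n} (G H : FinGroup n) {t} (c : Config m n) i {g y} →
  Wins G H t (pebG G c [ i ]≔ g) (pebH H c [ i ]≔ y) → SpoilerWins G H t (place c i (g , y))
Wins-placed⇒SpoilerWins G H c i {g} {y} =
  Wins⇒SpoilerWins G H _ _ (place-≗ proj₁ _ i (g , y) (λ _ → refl)) (place-≗ proj₂ _ i (g , y) (λ _ → refl))

commW : ∀ {m} → Word m → Word m → Word m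
commW v w = mul (mul (mul (inv v) (inv w)) v) w

module _ {m n : ℕ} (G H : FinGroup n) where
  private
    module H = FinGroupProperties H

  center-mismatch⇒Wins : ∀ {gs hs : Fin m → Fin n} {p q} → q ≢ p →
    InCenter G (gs p) → ¬ InCenter H (hs p) → Wins G H 1 gs hs
  center-mismatch⇒Wins {gs} {hs} {p} {q} q≢p central non-central
    with ¬∀⟶∃¬ n _ (λ h → hs p H.∙ h ≟ h H.∙ hs p) non-central
  ... | h , not-commuting = inj₂ (q , λ f →
    let (g , fg≡h) = Bijection.strictlySurjective f h in
    g , relation-violated G H (mul (var p) (var q)) (mul (var q) (var p))
          (subst (InCenter G) (sym (updateAt-minimal p q gs (q≢p ∘ sym))) central _)
          (not-commuting ∘ subst₂ (λ a b → a H.∙ b ≡ b H.∙ a)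
                                  (updateAt-minimal p q hs (q≢p ∘ sym)) (trans ([]≔-updates hs q _) fg≡h)))

  place-two : ∀ {t} {gs hs : Fin m → Fin n} {p q r} → Distinct₃ p q r → ∀ a b →
    (∀ {gs′ hs′ : Fin m → Fin n} → gs′ p ≡ gs p → gs′ q ≡ a → gs′ r ≡ b → hs′ p ≡ hs p →
       Wins G H t gs′ hs′) →
    Wins G H (2 + t) gs hs
  place-two {gs = gs} {hs} {q = q} {r} (p≢q , p≢r , q≢r) a b continue =
    inj₂ (q , λ f → a , inj₂ (r , λ f′ → b ,
      let (gp , gq , gr) = []≔-twice gs a b p≢q p≢r q≢r
          (hp , _)       = []≔-twice hs (Bijection.to f a) (Bijection.to f′ b) p≢q p≢r q≢r
      in continue gp gq gr hp))

  commutator-mismatch⇒Wins : ∀ {gs hs : Fin m → Fin n} {p q r a b} → Distinct₃ p q r →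
    gs p ≡ comm G a b → ¬ IsCommutator H (hs p) → Wins G H 2 gs hs
  commutator-mismatch⇒Wins {p = p} {q = q} {r = r} {a = a} {b = b} distinct gp≡[a,b] not-commutator =
    place-two distinct a b λ {gs′} {hs′} gp gq gr hp →
      relation-violated G H (var p) (commW (var q) (var r))
        (trans gp (trans gp≡[a,b] (sym (cong₂ (comm G) gq gr))))
        (λ eq → not-commutator (hs′ q , hs′ r , trans (sym eq) hp))

module _ {n : ℕ} (G H : FinGroup n) where
  private
    module G = FinGroupProperties G
    module H = FinGroupProperties H

  image-center-mismatch : (f : Fin n ⤖ Fin n) →
    ¬ ImageCenterEq G H (Bijection.to f) →
    Σ (Fin n) λ g → (InCenter G g × ¬ InCenter H (Bijection.to f g))
                  ⊎ (¬ InCenter G g × InCenter H (Bijection.to f g))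
  image-center-mismatch f different
    with any? (λ g → (G.InCenter? g ×-dec ¬? (H.InCenter? (Bijection.to f g)))
                   ⊎-dec (¬? (G.InCenter? g) ×-dec H.InCenter? (Bijection.to f g)))
  ... | yes mismatch = mismatch
  ... | no  none     = ⊥-elim (different (preserves , reflects))
    where
    preserves : ∀ z → InCenter G z → InCenter H (Bijection.to f z)
    preserves z central = decidable-stable (H.InCenter? _) λ non-central → none (z , inj₁ (central , non-central))
    reflects : ∀ h → InCenter H h → Σ (Fin _) λ z → InCenter G z × Bijection.to f z ≡ h
    reflects h central with Bijection.strictlySurjective f h
    ... | z , fz≡h = z , decidable-stable (G.InCenter? z)
                           (λ non-central → none (z , inj₂ (non-central , subst (InCenter H) (sym fz≡h) central)))
                     , fz≡h

Separates : ∀ {n} (G H : FinGroup n) → Fin n → Fin n → ℕ → Set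
Separates G H x y M = CommLen G x M × ¬ CommLen H y M

halvingRounds : ℕ → ℕ
halvingRounds zero    = 2
halvingRounds (suc e) = 2 + halvingRounds e

module Halving {m n : ℕ} (G H : FinGroup n) where
  private
    module G = FinGroupProperties G
    module H = FinGroupProperties H

  SeparationWins : ℕ → Set
  SeparationWins e = ∀ {gs hs : Fin m → Fin n} {p q r} → Distinct₃ p q r → ∀ {M} → M ≤ 2 ^ e →
    Separates G H (gs p) (hs p) M → Wins G H (halvingRounds e) gs hs

  separation-base : SeparationWins 0
  separation-base {p = p} _ {zero} _ (cl , ¬cl) =
    ¬Consistent⇒Wins G H 2
      (relation-violated G H (var p) one (G.CommLen-zero⇒ε cl) (λ hp≡ε → ¬cl ([] , refl , sym hp≡ε)))
  separation-base distinct {suc zero} _ (cl , ¬cl) =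
    let (a , b , [a,b]≡gp) = G.CommLen-one⇒IsCommutator cl
    in commutator-mismatch⇒Wins G H distinct (sym [a,b]≡gp) (¬cl ∘ H.IsCommutator⇒CommLen-one)
  separation-base _ {suc (suc _)} (s≤s ()) _

  -- If p = q r holds in H as well, one of the two factors must fail its commutator length.
  product-separation⇒Wins : ∀ {e} → SeparationWins e →
    ∀ {gs hs : Fin m → Fin n} {p q r a b} → Distinct₃ p q r →
    gs p ≡ gs q G.∙ gs r → CommLen G (gs q) a → CommLen G (gs r) b → a ≤ 2 ^ e → b ≤ 2 ^ e →
    ¬ CommLen H (hs p) (a + b) → Wins G H (halvingRounds e) gs hs
  product-separation⇒Wins IH {gs} {hs} {p} {q} {r} (p≢q , p≢r , q≢r) product cq cr a≤ b≤ ¬cl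
    with hs p ≟ hs q H.∙ hs r
  ... | no  not-product = ¬Consistent⇒Wins G H _
                            (relation-violated G H (var p) (mul (var q) (var r)) product not-product)
  ... | yes h-product with H.¬CommLen-∙ (subst (λ z → ¬ CommLen H z _) h-product ¬cl)
  ...   | inj₁ ¬cq = IH (p≢q ∘ sym , q≢r , p≢r) a≤ (cq , ¬cq)
  ...   | inj₂ ¬cr = IH (p≢r ∘ sym , q≢r ∘ sym , p≢q) b≤ (cr , ¬cr)

  halve : ∀ {e} → SeparationWins e →
    ∀ {gs hs : Fin m → Fin n} {p q r rest} → Distinct₃ p q r → rest ≤ 2 ^ e →
    Separates G H (gs p) (hs p) (2 ^ e + rest) → Wins G H (halvingRounds (suc e)) gs hs
  halve {e} IH distinct rest≤ (cl , ¬cl) with G.CommLen-split (2 ^ e) _ cl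
  ... | u , v , cu , cv , uv≡gp = place-two G H distinct u v λ gp gq gr hp →
    product-separation⇒Wins {e} IH distinct
      (trans gp (trans (sym uv≡gp) (sym (cong₂ G._∙_ gq gr))))
      (subst (λ z → CommLen G z _) (sym gq) cu) (subst (λ z → CommLen G z _) (sym gr) cv)
      ≤-refl rest≤ (subst (λ z → ¬ CommLen H z _) (sym hp) ¬cl)

  separation-step : ∀ {e} → SeparationWins e → SeparationWins (suc e)
  separation-step {e} IH {gs} {hs} {p} distinct {M} M≤ (cl , ¬cl) with M ≤? 2 ^ e
  ... | yes M≤half = Wins-mono G H (m≤n+m _ 2) (IH distinct M≤half (cl , ¬cl))
  ... | no  M≰half = halve {e} IH distinct rest≤half
                       (subst (λ k → Separates G H (gs p) (hs p) k) (sym half+rest≡M) (cl , ¬cl))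
    where
    half = 2 ^ e
    half+rest≡M : half + (M ∸ half) ≡ M
    half+rest≡M = m+[n∸m]≡n (<⇒≤ (≰⇒> M≰half))
    rest≤half : M ∸ half ≤ half
    rest≤half = ≤-trans (∸-monoˡ-≤ half M≤) (≤-reflexive (trans (m+n∸m≡n half (half + 0)) (+-identityʳ half)))

  separation⇒Wins : ∀ e → SeparationWins e
  separation⇒Wins zero    = separation-base
  separation⇒Wins (suc e) = separation-step {e} (separation⇒Wins e)

module _ {m n : ℕ} (G H : FinGroup n) where
  private
    module G = FinGroupProperties G

  width-gap⇒Wins : ∀ {k e} {gs hs : Fin m → Fin n} {p q r} → (∀ {g j} → CommLen G g j → CommLen G g k) →
    CW H (hs p) (just (suc k)) → suc k ≤ 2 ^ e → Distinct₃ p q r → Wins G H (halvingRounds e) gs hs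
  width-gap⇒Wins {k} {e} {gs} {p = p} saturated (cl , minimal) k<2^e distinct with G.CommLen? (gs p) k
  ... | yes cg  = Halving.separation⇒Wins G H e distinct (≤-trans (n≤1+n k) k<2^e) (cg , minimal k (n<1+n k))
  ... | no  ¬cg = Wins-swap G H _ (Halving.separation⇒Wins H G e distinct k<2^e (cl , ¬cg ∘ saturated))

  wide-element⇒Wins : ∀ {k e w} {gs hs : Fin m → Fin n} {p q r} → (∀ {g j} → CommLen G g j → CommLen G g k) →
    CW H w (just (suc k)) → suc k ≤ 2 ^ e → Distinct₃ p q r → Wins G H (suc (halvingRounds e)) gs hs
  wide-element⇒Wins {k} {e} {w} {hs = hs} {p} saturated cw k<2^e distinct = inj₂ (p , λ f →
    let (g , fg≡w) = Bijection.strictlySurjective f w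
    in g , width-gap⇒Wins {e = e} saturated
             (subst (λ h → CW H h (just (suc k))) (sym (trans ([]≔-updates hs p _) fg≡w)) cw) k<2^e distinct)

module _ {n : ℕ} (G H : FinGroup n) where
  private
    module G = FinGroupProperties G
    module H = FinGroupProperties H

  cw-mismatch : ∀ {k x y a b} → CWGroup G k → CW G x a → CW H y b → a ≢ b →
      (Σ ℕ λ M → M ≤ k × Separates G H x y M)
    ⊎ (Σ ℕ λ M → M ≤ k × Separates H G y x M)
    ⊎ (Σ (Fin n) λ w → CW H w (just (suc k)))
  cw-mismatch {a = nothing} {nothing} _ _ _ a≢b = ⊥-elim (a≢b refl)
  cw-mismatch {a = just a} {nothing} cwG cwa@(cla , _) y∉[H,H] _ =
    inj₁ (a , G.CWGroup⇒CW≤ cwG cwa , cla , y∉[H,H] a)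
  cw-mismatch {k} {a = nothing} {just b} _ x∉[G,G] cwb@(clb , _) _ with b ≤? k
  ... | yes b≤k = inj₂ (inj₁ (b , b≤k , clb , x∉[G,G] b))
  ... | no  b≰k = inj₂ (inj₂ (H.CW-prefix (suc k) (b ∸ suc k)
                               (subst (λ c → CW H _ (just c)) (sym (m+[n∸m]≡n (≰⇒> b≰k))) cwb)))
  cw-mismatch {a = just a} {just b} cwG cwa@(cla , mina) (clb , minb) a≢b with <-cmp a b
  ... | tri< a<b _ _ = inj₁ (a , G.CWGroup⇒CW≤ cwG cwa , cla , minb a a<b)
  ... | tri≈ _ a≡b _ = ⊥-elim (a≢b (cong just a≡b))
  ... | tri> _ _ b<a = inj₂ (inj₁ (b , ≤-trans (<⇒≤ b<a) (G.CWGroup⇒CW≤ cwG cwa) , clb , mina b b<a))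

<2^suc⌊log₂⌋ : ∀ k → k < 2 ^ suc ⌊log₂ k ⌋
<2^suc⌊log₂⌋ k = ≰⇒> λ 2^≤k →
  1+n≰n (subst (_≤ ⌊log₂ k ⌋) (⌊log₂[2^n]⌋≡n (suc ⌊log₂ k ⌋)) (⌊log₂⌋-mono-≤ 2^≤k))

halvingRounds-bound : ∀ e → suc (halvingRounds (suc e)) ≤ 5 * (e + 1)
halvingRounds-bound zero    = ≤-refl
halvingRounds-bound (suc e) = begin
  2 + suc (halvingRounds (suc e))  ≤⟨ +-monoʳ-≤ 2 (halvingRounds-bound e) ⟩
  2 + 5 * (e + 1)                  ≤⟨ +-monoˡ-≤ (5 * (e + 1)) (m≤m+n 2 3) ⟩
  5 + 5 * (e + 1)                  ≡⟨ *-suc 5 (e + 1) ⟨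
  5 * (suc e + 1)                  ∎
  where open ≤-Reasoning

center-mismatch-spoiler-wins : (n : ℕ) (G H : FinGroup n) (c : Config 2 n) (i : Fin 2) (f : Fin n ⤖ Fin n) →
  ¬ ImageCenterEq G H (Bijection.to f) →
  Σ (Fin n) λ g → SpoilerWins G H 1 (place c i (g , Bijection.to f g))
center-mismatch-spoiler-wins n G H c i f different with image-center-mismatch G H f different
... | g , inj₁ (central , non-central) = g , Wins-placed⇒SpoilerWins G H c i
  (center-mismatch⇒Wins G H (punchInᵢ≢i i zero) (subst (InCenter G) (sym ([]≔-updates _ i _)) central)
                                              (subst (¬_ ∘ InCenter H) (sym ([]≔-updates _ i _)) non-central))
... | g , inj₂ (non-central , central) = g , Wins-placed⇒SpoilerWins G H c i (Wins-swap G H 1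
  (center-mismatch⇒Wins H G (punchInᵢ≢i i zero) (subst (InCenter H) (sym ([]≔-updates _ i _)) central)
                                              (subst (¬_ ∘ InCenter G) (sym ([]≔-updates _ i _)) non-central)))

commutator-mismatch-spoiler-wins : (n : ℕ) (G H : FinGroup n) (c : Config 3 n) (i : Fin 3) (f : Fin n ⤖ Fin n) →
  (Σ (Fin n) λ x → Σ (Fin n) λ y → ¬ IsCommutator H (Bijection.to f (comm G x y))) →
  Σ (Fin n) λ g → SpoilerWins G H 2 (place c i (g , Bijection.to f g))
commutator-mismatch-spoiler-wins n G H c i f (x , y , not-commutator) =
  comm G x y , Wins-placed⇒SpoilerWins G H c i
    (commutator-mismatch⇒Wins G H (proj₂ (proj₂ (distinct-from i))) ([]≔-updates _ i _)
      (subst (¬_ ∘ IsCommutator H) (sym ([]≔-updates _ i _)) not-commutator))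

commutator-width-mismatch-spoiler-wins : (n : ℕ) (G H : FinGroup n) (c : Config 4 n) (i : Fin 4) (f : Fin n ⤖ Fin n) →
  (Σ (Fin n) λ x → Σ (Maybe ℕ) λ a → Σ (Maybe ℕ) λ b →
     CW G x a × CW H (Bijection.to f x) b × a ≢ b) →
  (k : ℕ) → CWGroup G k →
  k ≤ n × (Σ (Fin n) λ g → SpoilerWins G H (5 * (⌊log₂ k ⌋ + 1)) (place c i (g , Bijection.to f g)))
commutator-width-mismatch-spoiler-wins n G H c i f (x , a , b , cwa , cwb , a≢b) k cwG@((_ , cw-k) , _) =
    <⇒≤ (FinGroupProperties.CW⇒<order G cw-k)
  , x , Wins-placed⇒SpoilerWins G H c i
          (Wins-mono G H (halvingRounds-bound L) (play (cw-mismatch G H cwG cwa cwb a≢b)))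
  where
  L = ⌊log₂ k ⌋
  k<2^ : k < 2 ^ suc L
  k<2^ = <2^suc⌊log₂⌋ k
  gs = pebG G c [ i ]≔ x
  hs = pebH H c [ i ]≔ Bijection.to f x
  distinct : Distinct₃ i _ _
  distinct = proj₂ (proj₂ (distinct-from i))
  placed : (P : Fin n → Fin n → Set) → P x (Bijection.to f x) → P (gs i) (hs i)
  placed P = subst₂ P (sym ([]≔-updates _ i _)) (sym ([]≔-updates _ i _))
  play : (Σ ℕ λ M → M ≤ k × Separates G H x (Bijection.to f x) M)
       ⊎ (Σ ℕ λ M → M ≤ k × Separates H G (Bijection.to f x) x M)
       ⊎ (Σ (Fin n) λ w → CW H w (just (suc k))) →
       Wins G H (suc (halvingRounds (suc L))) gs hs
  play (inj₁ (M , M≤k , separates)) = Wins-mono G H (n≤1+n _)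
    (Halving.separation⇒Wins G H (suc L) distinct (≤-trans M≤k (<⇒≤ k<2^))
      (placed (λ u v → Separates G H u v M) separates))
  play (inj₂ (inj₁ (M , M≤k , separates))) = Wins-mono G H (n≤1+n _) (Wins-swap G H _
    (Halving.separation⇒Wins H G (suc L) distinct (≤-trans M≤k (<⇒≤ k<2^))
      (placed (λ u v → Separates H G v u M) separates)))
  play (inj₂ (inj₂ (w , cw))) =
    wide-element⇒Wins G H {e = suc L} (FinGroupProperties.CWGroup⇒CommLen G cwG) cw k<2^ distinct

mainTheorem16 :
    -- (a) f(Z(G)) ≠ Z(H) : Spoiler wins with 2 pebbles, 2 rounds (this one included)
    ((n : ℕ) (G H : FinGroup n) (c : Config 2 n) (i : Fin 2) (f : Fin n ⤖ Fin n) →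
      ¬ ImageCenterEq G H (Bijection.to f) →
      Σ (Fin n) λ g → SpoilerWins G H 1 (place c i (g , Bijection.to f g)))
    -- (b) f([x,y]) not a commutator : 3 pebbles, 3 rounds
    × ((n : ℕ) (G H : FinGroup n) (c : Config 3 n) (i : Fin 3) (f : Fin n ⤖ Fin n) →
      (Σ (Fin n) λ x → Σ (Fin n) λ y → ¬ IsCommutator H (Bijection.to f (comm G x y))) →
      Σ (Fin n) λ g → SpoilerWins G H 2 (place c i (g , Bijection.to f g)))
    -- (c) cw(g) ≠ cw(f g) : 4 pebbles, O(log cw(G)) rounds, and cw(G) ≤ n
    × (Σ ℕ λ C → (n : ℕ) (G H : FinGroup n) (c : Config 4 n) (i : Fin 4) (f : Fin n ⤖ Fin n) →
      (Σ (Fin n) λ x → Σ (Maybe ℕ) λ a → Σ (Maybe ℕ) λ b →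
         CW G x a × CW H (Bijection.to f x) b × a ≢ b) →
      (k : ℕ) → CWGroup G k →
      k ≤ n
      × (Σ (Fin n) λ g →
           SpoilerWins G H (C * (⌊log₂ k ⌋ + 1)) (place c i (g , Bijection.to f g))))
mainTheorem16 =
    center-mismatch-spoiler-wins
  , commutator-mismatch-spoiler-wins
  , 5 , commutator-width-mismatch-spoiler-wins
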